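{- Let $n\ge0$ and let $\frac{p}{q}$ and $\frac{r}{s}$ be consecutive terms of $SB_n$ (in lowest terms, positive denominators). Then $\gcd(2p+r,2q+s)=\gcd(p+2r,q+2s)$, i.e. the left mediant reduces by the same factor as the right mediant.
   Context: The unit weight-$3$ Stern–Brocot sequences $SB_n$ ($n\ge0$): $SB_0=(\frac{0}{1},\frac{1}{1})$, and $SB_{n+1}$ is obtained from $SB_n$ by keeping all its terms in order and inserting, between each pair of consecutive terms $\frac{p}{q},\frac{r}{s}$ (in lowest terms, positive denominators), the two fractions $\frac{2p+r}{2q+s}$ (left mediant) and $\frac{p+2r}{q+2s}$ (right mediant), each reduced to lowest terms, in this order. -}

module Defs where

open import Data.Nat using (ℕ; zero; suc; _+_; _*_; _/_)
open import Data.Nat.GCD using (gcd)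
open import Data.Product using (_×_; _,_)
open import Data.List using (List; []; _∷_)

-- A nonnegative fraction p/q is represented by the pair (p , q).
Frac : Set
Frac = ℕ × ℕ

-- Reduce a fraction to lowest terms by dividing numerator and denominator
-- by their gcd (the gcd is nonzero whenever the denominator is positive;
-- the degenerate case 0/0 is left unchanged and never occurs).
reduce : Frac → Frac
reduce (a , b) with gcd a b
... | zero  = (a , b)
... | suc g = (a / suc g , b / suc g)

leftMed : Frac → Frac → Frac
leftMed (p , q) (r , s) = reduce (2 * p + r , 2 * q + s)

rightMed : Frac → Frac → Frac
rightMed (p , q) (r , s) = reduce (p + 2 * r , q + 2 * s)

refine : List Frac → List Frac
refine [] = []
refine (x ∷ []) = x ∷ []
refine (x ∷ y ∷ rest) = x ∷ leftMed x y ∷ rightMed x y ∷ refine (y ∷ rest)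

SB : ℕ → List Frac
SB zero = (0 , 1) ∷ (1 , 1) ∷ []
SB (suc n) = refine (SB n)

-- Regard p/q as the integer vector (p, q) and put det (p, q) (r, s) = qr − ps.
-- Consecutive terms u, v of SB_n are adjacent: for some k and some w with
-- det u w = 1, either v = u + 3^k w or v = 3^k w − u.  In the second case
-- the mediants 2u + v = u + 3^k w and u + 2v = 3^(k+1) w − (u + 3^k w) have
-- determinant ±1 against w, hence are primitive; in the first case with k ≥ 1
-- both mediants are 3 times such a vector, and for k = 0 the first case is an
-- instance of the second.  So the two mediants have the same content, and
-- their reductions cut u, v into three consecutive adjacent pairs.
module Submission where

open import Defs
open import Data.Nat using (ℕ; zero; suc; _+_; _*_; _/_; NonZero; nonZero)
open import Data.Nat.GCD using (gcd; gcd[m,n]∣m; gcd[m,n]∣n; gcd-greatest)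
open import Data.Nat.Divisibility using (_∣_; ∣-antisym)
open import Data.Nat.DivMod using (m*[n/m]≡n)
open import Data.Integer as ℤ using (ℤ; +_; 1ℤ; -1ℤ; _^_)
import Data.Integer.Properties as ℤ
open import Data.Integer.Divisibility.Signed as ℤ∣
  using (divides; ∣ᵤ⇒∣; ∣⇒∣ᵤ; ∣m⇒∣m*n; ∣m∣n⇒∣m-n)
open import Data.Integer.Tactic.RingSolver using (solve-∀)
open import Data.Product using (∃; _×_; _,_; proj₁; proj₂)
open import Data.List using (List; []; _∷_; _++_)
open import Data.List.Relation.Unary.Linked using (Linked; []; [-]; _∷_)
open import Function using (_on_)
open import Relation.Binary using (Rel)
open import Relation.Binary.PropositionalEquality
  using (_≡_; refl; sym; trans; cong; cong₂; subst; subst₂; module ≡-Reasoning)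

ℤ² : Set
ℤ² = ℤ × ℤ

infixl 6 _⊕_
infixr 7 _·_

_⊕_ : ℤ² → ℤ² → ℤ²
(p , q) ⊕ (r , s) = (p ℤ.+ r , q ℤ.+ s)

_·_ : ℤ → ℤ² → ℤ²
c · (p , q) = (c ℤ.* p , c ℤ.* q)

det : ℤ² → ℤ² → ℤ
det (p , q) (r , s) = q ℤ.* r ℤ.- p ℤ.* s

Primitive : ℤ² → Set
Primitive u = ∃ λ w → det u w ≡ 1ℤ

det-scaleˡ : ∀ c u w → det (c · u) w ≡ c ℤ.* det u w
det-scaleˡ c (p , q) (r , s) = σ c p q r s
  where
  σ : ∀ c p q r s → c ℤ.* q ℤ.* r ℤ.- c ℤ.* p ℤ.* s ≡ c ℤ.* (q ℤ.* r ℤ.- p ℤ.* s)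
  σ = solve-∀

det-shearˡ : ∀ u w c → det (u ⊕ c · w) w ≡ det u w
det-shearˡ (p , q) (r , s) c = σ p q r s c
  where
  σ : ∀ p q r s c → (q ℤ.+ c ℤ.* s) ℤ.* r ℤ.- (p ℤ.+ c ℤ.* r) ℤ.* s ≡ q ℤ.* r ℤ.- p ℤ.* s
  σ = solve-∀

det-shearʳ : ∀ u w c → det u (c · u ⊕ w) ≡ det u w
det-shearʳ (p , q) (r , s) c = σ p q r s c
  where
  σ : ∀ p q r s c → q ℤ.* (c ℤ.* p ℤ.+ r) ℤ.- p ℤ.* (c ℤ.* q ℤ.+ s) ≡ q ℤ.* r ℤ.- p ℤ.* s
  σ = solve-∀

det-reflect : ∀ u w c → det (c · w ⊕ -1ℤ · u) (-1ℤ · w) ≡ det u w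
det-reflect (p , q) (r , s) c = σ p q r s c
  where
  σ : ∀ p q r s c → (c ℤ.* s ℤ.+ -1ℤ ℤ.* q) ℤ.* (-1ℤ ℤ.* r) ℤ.- (c ℤ.* r ℤ.+ -1ℤ ℤ.* p) ℤ.* (-1ℤ ℤ.* s)
                    ≡ q ℤ.* r ℤ.- p ℤ.* s
  σ = solve-∀

∣det : ∀ {k p q} w → k ℤ∣.∣ p → k ℤ∣.∣ q → k ℤ∣.∣ det (p , q) w
∣det (r , s) k∣p k∣q = ∣m∣n⇒∣m-n (∣m⇒∣m*n r k∣q) (∣m⇒∣m*n s k∣p)

data Adjacent (u v : ℤ²) : Set where
  same     : ∀ k w → det u w ≡ 1ℤ → v ≡ u ⊕ (+ 3) ^ k · w → Adjacent u v
  opposite : ∀ k w → det u w ≡ 1ℤ → v ≡ (+ 3) ^ k · w ⊕ -1ℤ · u → Adjacent u v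

adjacent⇒primitive : ∀ {u v} → Adjacent u v → Primitive u
adjacent⇒primitive (same _ w d _)     = w , d
adjacent⇒primitive (opposite _ w d _) = w , d

record Trisection (u v : ℤ²) : Set where
  field
    scale          : ℕ
    scale≢0        : NonZero scale
    left right     : ℤ²
    left-scaled    : + 2 · u ⊕ v ≡ + scale · left
    right-scaled   : u ⊕ + 2 · v ≡ + scale · right
    adjacent-left  : Adjacent u left
    adjacent-mid   : Adjacent left right
    adjacent-right : Adjacent right v

mediantˡ-opposite : ∀ u w D → + 2 · u ⊕ (D · w ⊕ -1ℤ · u) ≡ + 1 · (u ⊕ D · w)
mediantˡ-opposite (p , q) (r , s) D = cong₂ _,_ (σ p r D) (σ q s D)
  where
  σ : ∀ p r D → + 2 ℤ.* p ℤ.+ (D ℤ.* r ℤ.+ -1ℤ ℤ.* p) ≡ + 1 ℤ.* (p ℤ.+ D ℤ.* r)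
  σ = solve-∀

mediantʳ-opposite : ∀ u w D → u ⊕ + 2 · (D · w ⊕ -1ℤ · u) ≡ + 1 · ((+ 3 ℤ.* D) · w ⊕ -1ℤ · (u ⊕ D · w))
mediantʳ-opposite (p , q) (r , s) D = cong₂ _,_ (σ p r D) (σ q s D)
  where
  σ : ∀ p r D → p ℤ.+ + 2 ℤ.* (D ℤ.* r ℤ.+ -1ℤ ℤ.* p) ≡ + 1 ℤ.* (+ 3 ℤ.* D ℤ.* r ℤ.+ -1ℤ ℤ.* (p ℤ.+ D ℤ.* r))
  σ = solve-∀

opposite-step : ∀ u w D → D · w ⊕ -1ℤ · u ≡ (+ 3 ℤ.* D) · w ⊕ -1ℤ · (u ⊕ D · w) ⊕ D · (-1ℤ · w)
opposite-step (p , q) (r , s) D = cong₂ _,_ (σ p r D) (σ q s D)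
  where
  σ : ∀ p r D → D ℤ.* r ℤ.+ -1ℤ ℤ.* p ≡ + 3 ℤ.* D ℤ.* r ℤ.+ -1ℤ ℤ.* (p ℤ.+ D ℤ.* r) ℤ.+ D ℤ.* (-1ℤ ℤ.* r)
  σ = solve-∀

mediantˡ-same : ∀ u w D → + 2 · u ⊕ (u ⊕ (+ 3 ℤ.* D) · w) ≡ + 3 · (u ⊕ D · w)
mediantˡ-same (p , q) (r , s) D = cong₂ _,_ (σ p r D) (σ q s D)
  where
  σ : ∀ p r D → + 2 ℤ.* p ℤ.+ (p ℤ.+ + 3 ℤ.* D ℤ.* r) ≡ + 3 ℤ.* (p ℤ.+ D ℤ.* r)
  σ = solve-∀

mediantʳ-same : ∀ u w D → u ⊕ + 2 · (u ⊕ (+ 3 ℤ.* D) · w) ≡ + 3 · (u ⊕ D · w ⊕ D · w)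
mediantʳ-same (p , q) (r , s) D = cong₂ _,_ (σ p r D) (σ q s D)
  where
  σ : ∀ p r D → p ℤ.+ + 2 ℤ.* (p ℤ.+ + 3 ℤ.* D ℤ.* r) ≡ + 3 ℤ.* (p ℤ.+ D ℤ.* r ℤ.+ D ℤ.* r)
  σ = solve-∀

same-step : ∀ u w D → u ⊕ (+ 3 ℤ.* D) · w ≡ u ⊕ D · w ⊕ D · w ⊕ D · w
same-step (p , q) (r , s) D = cong₂ _,_ (σ p r D) (σ q s D)
  where
  σ : ∀ p r D → p ℤ.+ + 3 ℤ.* D ℤ.* r ≡ p ℤ.+ D ℤ.* r ℤ.+ D ℤ.* r ℤ.+ D ℤ.* r
  σ = solve-∀

same-unit-as-opposite : ∀ u w → u ⊕ 1ℤ · w ≡ 1ℤ · (+ 2 · u ⊕ w) ⊕ -1ℤ · u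
same-unit-as-opposite (p , q) (r , s) = cong₂ _,_ (σ p r) (σ q s)
  where
  σ : ∀ p r → p ℤ.+ 1ℤ ℤ.* r ≡ 1ℤ ℤ.* (+ 2 ℤ.* p ℤ.+ r) ℤ.+ -1ℤ ℤ.* p
  σ = solve-∀

trisect-opposite : ∀ {u} k w → det u w ≡ 1ℤ → Trisection u ((+ 3) ^ k · w ⊕ -1ℤ · u)
trisect-opposite {u} k w d = record
  { scale          = 1
  ; scale≢0        = nonZero
  ; left           = u ⊕ D · w
  ; right          = (+ 3) ^ suc k · w ⊕ -1ℤ · (u ⊕ D · w)
  ; left-scaled    = mediantˡ-opposite u w D
  ; right-scaled   = mediantʳ-opposite u w D
  ; adjacent-left  = same k w d refl
  ; adjacent-mid   = opposite (suc k) w det-left refl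
  ; adjacent-right = same k (-1ℤ · w) (trans (det-reflect (u ⊕ D · w) w ((+ 3) ^ suc k)) det-left) (opposite-step u w D)
  }
  where
  D = (+ 3) ^ k
  det-left : det (u ⊕ D · w) w ≡ 1ℤ
  det-left = trans (det-shearˡ u w D) d

trisect : ∀ {u v} → Adjacent u v → Trisection u v
trisect (opposite k w d refl) = trisect-opposite k w d
trisect {u} (same zero w d refl) =
  subst (Trisection u) (sym (same-unit-as-opposite u w))
    (trisect-opposite 0 (+ 2 · u ⊕ w) (trans (det-shearʳ u w (+ 2)) d))
trisect {u} (same (suc k) w d refl) = record
  { scale          = 3
  ; scale≢0        = nonZero
  ; left           = u ⊕ D · w
  ; right          = u ⊕ D · w ⊕ D · w
  ; left-scaled    = mediantˡ-same u w D
  ; right-scaled   = mediantʳ-same u w D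
  ; adjacent-left  = same k w d refl
  ; adjacent-mid   = same k w det-left refl
  ; adjacent-right = same k w (trans (det-shearˡ (u ⊕ D · w) w D) det-left) (same-step u w D)
  }
  where
  D = (+ 3) ^ k
  det-left : det (u ⊕ D · w) w ≡ 1ℤ
  det-left = trans (det-shearˡ u w D) d

ι : Frac → ℤ²
ι (a , b) = (+ a , + b)

content : Frac → ℕ
content (a , b) = gcd a b

mediantˡ : Frac → Frac → Frac
mediantˡ (p , q) (r , s) = (2 * p + r , 2 * q + s)

mediantʳ : Frac → Frac → Frac
mediantʳ (p , q) (r , s) = (p + 2 * r , q + 2 * s)

ι-mediantˡ : ∀ u v → ι (mediantˡ u v) ≡ + 2 · ι u ⊕ ι v
ι-mediantˡ (p , q) (r , s) = cong₂ _,_ (hom p r) (hom q s)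
  where
  hom : ∀ p r → + (2 * p + r) ≡ + 2 ℤ.* + p ℤ.+ + r
  hom p r = trans (ℤ.pos-+ (2 * p) r) (cong (ℤ._+ + r) (ℤ.pos-* 2 p))

ι-mediantʳ : ∀ u v → ι (mediantʳ u v) ≡ ι u ⊕ + 2 · ι v
ι-mediantʳ (p , q) (r , s) = cong₂ _,_ (hom p r) (hom q s)
  where
  hom : ∀ p r → + (p + 2 * r) ≡ + p ℤ.+ + 2 ℤ.* + r
  hom p r = trans (ℤ.pos-+ p (2 * r)) (cong (ℤ._+_ (+ p)) (ℤ.pos-* 2 r))

∣-of-scaled : ∀ {a m i} → + a ≡ + m ℤ.* i → m ∣ a
∣-of-scaled {a} {m} {i} eq = ∣⇒∣ᵤ {+ m} {+ a} (divides i (trans eq (ℤ.*-comm (+ m) i)))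

content-scaled : ∀ {m x y} → Primitive y → ι x ≡ + m · y → content x ≡ m
content-scaled {m} {a , b} {y} (w , det≡1) eq = ∣-antisym content∣m m∣content
  where
  open ≡-Reasoning
  det≡m : det (ι (a , b)) w ≡ + m
  det≡m = begin
    det (ι (a , b)) w   ≡⟨ cong (λ z → det z w) eq ⟩
    det (+ m · y) w     ≡⟨ det-scaleˡ (+ m) y w ⟩
    + m ℤ.* det y w     ≡⟨ cong (+ m ℤ.*_) det≡1 ⟩
    + m ℤ.* 1ℤ          ≡⟨ ℤ.*-identityʳ (+ m) ⟩
    + m                 ∎
  content∣m : gcd a b ∣ m
  content∣m = ∣⇒∣ᵤ (subst (+ gcd a b ℤ∣.∣_) det≡m
    (∣det {+ gcd a b} {+ a} {+ b} w (∣ᵤ⇒∣ (gcd[m,n]∣m a b)) (∣ᵤ⇒∣ (gcd[m,n]∣n a b))))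
  m∣content : m ∣ gcd a b
  m∣content = gcd-greatest (∣-of-scaled (cong proj₁ eq)) (∣-of-scaled (cong proj₂ eq))

reduce-by-content : ∀ a b {d} → gcd a b ≡ suc d → reduce (a , b) ≡ (a / suc d , b / suc d)
reduce-by-content a b eq rewrite eq = refl

exact-quotient : ∀ {a m i} ⦃ _ : NonZero m ⦄ → + a ≡ + m ℤ.* i → + (a / m) ≡ i
exact-quotient {a} {m} {i} eq = ℤ.*-cancelˡ-≡ (+ m) (+ (a / m)) i (begin
  + m ℤ.* + (a / m)   ≡⟨ ℤ.pos-* m (a / m) ⟨
  + (m * (a / m))     ≡⟨ cong +_ (m*[n/m]≡n (∣-of-scaled eq)) ⟩
  + a                 ≡⟨ eq ⟩
  + m ℤ.* i           ∎)
  where open ≡-Reasoning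

reduce-scaled : ∀ {m} ⦃ _ : NonZero m ⦄ {x y} → Primitive y → ι x ≡ + m · y → ι (reduce x) ≡ y
reduce-scaled {suc _} {a , b} prim eq =
  trans (cong ι (reduce-by-content a b (content-scaled prim eq)))
        (cong₂ _,_ (exact-quotient (cong proj₁ eq)) (exact-quotient (cong proj₂ eq)))

module _ {u v : Frac} (adj : (Adjacent on ι) u v) where
  open Trisection (trisect adj)

  private
    mediantˡ-scaled : ι (mediantˡ u v) ≡ + scale · left
    mediantˡ-scaled = trans (ι-mediantˡ u v) left-scaled

    mediantʳ-scaled : ι (mediantʳ u v) ≡ + scale · right
    mediantʳ-scaled = trans (ι-mediantʳ u v) right-scaled

  content-mediants : content (mediantˡ u v) ≡ content (mediantʳ u v)
  content-mediants =
    trans (content-scaled {scale} (adjacent⇒primitive adjacent-mid) mediantˡ-scaled)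
          (sym (content-scaled {scale} (adjacent⇒primitive adjacent-right) mediantʳ-scaled))

  refine-adjacent : (Adjacent on ι) u (leftMed u v)
                  × (Adjacent on ι) (leftMed u v) (rightMed u v)
                  × (Adjacent on ι) (rightMed u v) v
  refine-adjacent =
    subst (Adjacent (ι u)) (sym ι-leftMed) adjacent-left ,
    subst₂ Adjacent (sym ι-leftMed) (sym ι-rightMed) adjacent-mid ,
    subst (λ x → Adjacent x (ι v)) (sym ι-rightMed) adjacent-right
    where
    ι-leftMed : ι (leftMed u v) ≡ left
    ι-leftMed = reduce-scaled ⦃ scale≢0 ⦄ (adjacent⇒primitive adjacent-mid) mediantˡ-scaled
    ι-rightMed : ι (rightMed u v) ≡ right
    ι-rightMed = reduce-scaled ⦃ scale≢0 ⦄ (adjacent⇒primitive adjacent-right) mediantʳ-scaled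

refine⁺ : ∀ {ℓ} {R : Rel Frac ℓ} →
          (∀ {u v} → R u v → R u (leftMed u v) × R (leftMed u v) (rightMed u v) × R (rightMed u v) v) →
          ∀ {xs} → Linked R xs → Linked R (refine xs)
refine⁺ split []                  = []
refine⁺ split [-]                 = [-]
refine⁺ split (Rxy ∷ [-])         =
  let Rxl , Rlr , Rry = split Rxy in Rxl ∷ Rlr ∷ Rry ∷ [-]
refine⁺ split (Rxy ∷ Rys@(_ ∷ _)) =
  let Rxl , Rlr , Rry = split Rxy in Rxl ∷ Rlr ∷ Rry ∷ refine⁺ split Rys

linked-++-∷-∷ : ∀ {a ℓ} {A : Set a} {R : Rel A ℓ} xs {x y ys} →
                Linked R (xs ++ x ∷ y ∷ ys) → R x y
linked-++-∷-∷ []               (Rxy ∷ _) = Rxy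
linked-++-∷-∷ (_ ∷ [])         (_ ∷ Rs)  = linked-++-∷-∷ [] Rs
linked-++-∷-∷ (_ ∷ xs@(_ ∷ _)) (_ ∷ Rs)  = linked-++-∷-∷ xs Rs

SB-adjacent : ∀ n → Linked (Adjacent on ι) (SB n)
SB-adjacent zero    = same 0 (+ 1 , + 0) refl refl ∷ [-]
SB-adjacent (suc n) = refine⁺ refine-adjacent (SB-adjacent n)

lemma10 : (n p q r s : ℕ) (xs ys : List Frac) →
          SB n ≡ xs ++ ((p , q) ∷ (r , s) ∷ ys) →
          gcd (2 * p + r) (2 * q + s) ≡ gcd (p + 2 * r) (q + 2 * s)
lemma10 n p q r s xs ys eq =
  content-mediants (linked-++-∷-∷ xs (subst (Linked (Adjacent on ι)) eq (SB-adjacent n)))
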